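{- Let $i\geq1$ and $n\geq1$. The perimeter $L(n,i)$ (length of the boundary word) of the $i$-generalized Fibonacci snowflake of order $n$ is $L(n,i)=4F^{[i]}_{3n-1}$ if $i$ is even and $L(n,i)=4F^{[i]}_{3n+1}$ if $i$ is odd.
   Context: $F^{[i]}_0=1$, $F^{[i]}_1=i$, $F^{[i]}_n=F^{[i]}_{n-1}+F^{[i]}_{n-2}$. Alphabet $\mathcal{A}=\{0,1,2,3\}$ with addition mod 4; letters are unit steps $0=(1,0),1=(0,1),2=(-1,0),3=(0,-1)$. For $w=w_1\cdots w_m$, $\Sigma^\circ_\alpha(w)=\alpha(\alpha+w_1)\cdots(\alpha+w_1+\cdots+w_{m-1})$. Morphism $\overline{\cdot}$: $\overline{0}=0,\overline{1}=3,\overline{2}=2,\overline{3}=1$. Words $q^{[i]}_n$: if $i$ is even, $q^{[i]}_0=\varepsilon$, $q^{[i]}_1=1$, $q^{[i]}_2=(13)^{i/2}$, and for $n\ge3$, $q^{[i]}_n=q^{[i]}_{n-1}q^{[i]}_{n-2}$ if $n\equiv1\pmod3$, $q^{[i]}_n=q^{[i]}_{n-1}\overline{q^{[i]}_{n-2}}$ if $n\equiv0,2\pmod3$; if $i$ is odd, $q^{[i]}_0=\varepsilon$, $q^{[i]}_1=1$, $q^{[i]}_2=(13)^{(i-1)/2}1$, and for $n\ge3$, $q^{[i]}_n=q^{[i]}_{n-1}q^{[i]}_{n-2}$ if $n\equiv0\pmod3$, $q^{[i]}_n=q^{[i]}_{n-1}\overline{q^{[i]}_{n-2}}$ if $n\equiv1,2\pmod3$.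 The $i$-generalized Fibonacci snowflake of order $n$ is the polyomino whose boundary word is $\Sigma^\circ_\alpha((q^{[i]}_{3n})^4)$ if $i$ is even, resp. $\Sigma^\circ_\alpha((q^{[i]}_{3n+2})^4)$ if $i$ is odd, for some $\alpha\in\mathcal{A}$. -}

module Defs where

open import Data.Nat using (ℕ; zero; suc; _+_; _*_; _%_)
open import Data.Nat.Properties using (_≟_)
open import Data.Nat.DivMod using (m%n<n)
open import Data.Nat.Base using (_/_)
open import Data.Bool using (Bool; true; false; if_then_else_)
open import Data.Fin using (Fin)
open import Data.Fin as Fin using ()
open import Data.List using (List; []; _∷_; _++_; map)
open import Data.Product using (_×_; _,_; proj₁; proj₂)
open import Relation.Nullary.Decidable using (⌊_⌋)

F : ℕ → ℕ → ℕ
F i zero = 1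
F i (suc zero) = i
F i (suc (suc n)) = F i (suc n) + F i n

Letter : Set
Letter = Fin 4

_⊕_ : Letter → Letter → Letter
a ⊕ b = Fin.fromℕ< (m%n<n (Fin.toℕ a + Fin.toℕ b) 4)

Word : Set
Word = List Letter

-- Unit steps associated with letters (0=(1,0),1=(0,1),2=(-1,0),3=(0,-1));
-- recorded for completeness, not needed for the length statement.

barL : Letter → Letter
barL Fin.zero = Fin.zero
barL (Fin.suc Fin.zero) = Fin.suc (Fin.suc (Fin.suc Fin.zero))
barL (Fin.suc (Fin.suc Fin.zero)) = Fin.suc (Fin.suc Fin.zero)
barL (Fin.suc (Fin.suc (Fin.suc Fin.zero))) = Fin.suc Fin.zero

bar : Word → Word
bar = map barL

l1 l3 : Letter
l1 = Fin.suc Fin.zero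
l3 = Fin.suc (Fin.suc (Fin.suc Fin.zero))

Σ° : Letter → Word → Word
Σ° α [] = []
Σ° α (w ∷ ws) = α ∷ Σ° (α ⊕ w) ws

pow : Word → ℕ → Word
pow w zero = []
pow w (suc k) = w ++ pow w k

isEven : ℕ → Bool
isEven n = ⌊ n % 2 ≟ 0 ⌋

q2 : ℕ → Word
q2 i = if isEven i then pow (l1 ∷ l3 ∷ []) (i / 2)
                   else pow (l1 ∷ l3 ∷ []) (i / 2) ++ (l1 ∷ [])

plainStep : ℕ → ℕ → Bool
plainStep i n = if isEven i then ⌊ n % 3 ≟ 1 ⌋ else ⌊ n % 3 ≟ 0 ⌋

-- qPair i n = (q_{n+1}, q_n)
qPair : ℕ → ℕ → Word × Word
qPair i zero = (l1 ∷ [] , [])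
qPair i (suc zero) = (q2 i , l1 ∷ [])
qPair i (suc (suc n)) with qPair i (suc n)
... | (a , b) = ((if plainStep i (suc (suc (suc n))) then a ++ b else a ++ bar b) , a)

q : ℕ → ℕ → Word
q i n = proj₂ (qPair i n)

snowflakeBoundary : ℕ → ℕ → Letter → Word
snowflakeBoundary i n α =
  if isEven i then Σ° α (pow (q i (3 * n)) 4)
              else Σ° α (pow (q i (3 * n + 2)) 4)

module Submission where

-- The boundary word is Σ°_α (q^4) with q = q_{3n} (i even) or q = q_{3n+2}
-- (i odd).  Σ° emits exactly one letter per input letter and w ↦ w^4
-- multiplies length by 4, so the perimeter is 4 |q|.  Since the bar morphism
-- is letter-to-letter, both recursion rules q_{n-1} q_{n-2} and
-- q_{n-1} bar(q_{n-2}) give |q_n| = |q_{n-1}| + |q_{n-2}|; with |q_1| = 1 and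
-- |q_2| = i (both for even and odd i) this is the recurrence of F^{[i]},
-- shifted by one: |q_{m+1}| = F^{[i]}_m.

open import Defs
open import Data.Nat using (ℕ; zero; suc; _+_; _*_; _∸_; _≥_; _<_; _%_; _/_; s≤s)
open import Data.Nat.Properties using (+-comm; +-suc; _≟_)
open import Data.Nat.DivMod using (m%n<n; m≡m%n+[m/n]*n)
open import Data.List using (length; []; _∷_; _++_)
open import Data.List.Properties using (length-map; length-++)
open import Data.Bool using (Bool; true; false; if_then_else_)
open import Data.Product using (_×_; _,_; proj₁)
open import Relation.Binary.PropositionalEquality
  using (_≡_; refl; sym; cong; cong₂; module ≡-Reasoning)
open import Relation.Nullary.Decidable using (⌊_⌋)

open ≡-Reasoning

length-Σ° : ∀ (α : Letter) (w : Word) → length (Σ° α w) ≡ length w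
length-Σ° α []       = refl
length-Σ° α (x ∷ w) = cong suc (length-Σ° (α ⊕ x) w)

length-pow : ∀ (w : Word) (k : ℕ) → length (pow w k) ≡ k * length w
length-pow w zero    = refl
length-pow w (suc k) = begin
  length (w ++ pow w k)          ≡⟨ length-++ w ⟩
  length w + length (pow w k)    ≡⟨ cong (length w +_) (length-pow w k) ⟩
  length w + k * length w        ∎

length-boundary : ∀ (α : Letter) (w : Word) → length (Σ° α (pow w 4)) ≡ 4 * length w
length-boundary α w = begin
  length (Σ° α (pow w 4))  ≡⟨ length-Σ° α (pow w 4) ⟩
  length (pow w 4)         ≡⟨ length-pow w 4 ⟩
  4 * length w             ∎

length-step : ∀ (b : Bool) (x y : Word) →
  length (if b then x ++ y else x ++ bar y) ≡ length x + length y
length-step true  x y = length-++ x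
length-step false x y = begin
  length (x ++ bar y)        ≡⟨ length-++ x ⟩
  length x + length (bar y)  ≡⟨ cong (length x +_) (length-map barL y) ⟩
  length x + length y        ∎

length-q2 : ∀ (i : ℕ) → length (q2 i) ≡ i
length-q2 i = byRemainder (i % 2) (m%n<n i 2) (m≡m%n+[m/n]*n i 2)
  where
  13-block : Word
  13-block = l1 ∷ l3 ∷ []

  byRemainder : ∀ r → r < 2 → i ≡ r + (i / 2) * 2 →
    length (if ⌊ r ≟ 0 ⌋ then pow 13-block (i / 2)
                         else pow 13-block (i / 2) ++ (l1 ∷ [])) ≡ i
  byRemainder zero          _ i≡ = begin
    length (pow 13-block (i / 2))  ≡⟨ length-pow 13-block (i / 2) ⟩
    (i / 2) * 2                    ≡⟨ sym i≡ ⟩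
    i                              ∎
  byRemainder (suc zero)    _ i≡ = begin
    length (pow 13-block (i / 2) ++ (l1 ∷ []))  ≡⟨ length-++ (pow 13-block (i / 2)) ⟩
    length (pow 13-block (i / 2)) + 1           ≡⟨ cong (_+ 1) (length-pow 13-block (i / 2)) ⟩
    (i / 2) * 2 + 1                             ≡⟨ +-comm ((i / 2) * 2) 1 ⟩
    1 + (i / 2) * 2                             ≡⟨ sym i≡ ⟩
    i                                           ∎
  byRemainder (suc (suc r)) (s≤s (s≤s ())) _

q-shift : ∀ (i n : ℕ) → q i (suc n) ≡ proj₁ (qPair i n)
q-shift i zero    = refl
q-shift i (suc n) = refl

length-q : ∀ (i n : ℕ) → length (q i (suc n)) ≡ F i n
length-q i zero          = refl
length-q i (suc zero)    = length-q2 i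
length-q i (suc (suc n)) = begin
  length (q i (suc (suc (suc n))))
    ≡⟨ length-step (plainStep i (suc (suc (suc n))))
                   (q i (suc (suc n))) (q i (suc n)) ⟩
  length (q i (suc (suc n))) + length (q i (suc n))
    ≡⟨ cong₂ _+_ (length-q i (suc n)) (length-q i n) ⟩
  F i (suc n) + F i n
    ∎

-- The theorem.  For n = k + 1 the indices reduce as 3n = (3n ∸ 1) + 1 by
-- computation and 3n + 2 = (3n + 1) + 1 by +-suc.
proposition12 : (i n : ℕ) → i ≥ 1 → n ≥ 1 → (α : Letter) →
    (isEven i ≡ true → length (snowflakeBoundary i n α) ≡ 4 * F i (3 * n ∸ 1)) ×
    (isEven i ≡ false → length (snowflakeBoundary i n α) ≡ 4 * F i (3 * n + 1))
proposition12 i n@(suc _) _ _ α = evenCase , oddCase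
  where
  evenCase : isEven i ≡ true → length (snowflakeBoundary i n α) ≡ 4 * F i (3 * n ∸ 1)
  evenCase even rewrite even = begin
    length (Σ° α (pow (q i (3 * n)) 4))  ≡⟨ length-boundary α (q i (3 * n)) ⟩
    4 * length (q i (3 * n))             ≡⟨ cong (4 *_) (length-q i (3 * n ∸ 1)) ⟩
    4 * F i (3 * n ∸ 1)                  ∎

  oddCase : isEven i ≡ false → length (snowflakeBoundary i n α) ≡ 4 * F i (3 * n + 1)
  oddCase odd rewrite odd = begin
    length (Σ° α (pow (q i (3 * n + 2)) 4))  ≡⟨ length-boundary α (q i (3 * n + 2)) ⟩
    4 * length (q i (3 * n + 2))             ≡⟨ cong (λ m → 4 * length (q i m)) (+-suc (3 * n) 1) ⟩
    4 * length (q i (suc (3 * n + 1)))       ≡⟨ cong (4 *_) (length-q i (3 * n + 1)) ⟩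
    4 * F i (3 * n + 1)                      ∎
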